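{- Let $G$ be an $(e,d)$-reducible DAG with $N$ vertices. Then $\mathsf{superconc}(G)$ is $\left(e+\frac{N}{d},\,2d+\log(42N)\right)$-reducible.
   Context: A DAG $H=(V,E)$ is $(e,d)$-reducible if there exists $S\subseteq V$ with $|S|\le e$ such that the longest directed path in $H-S$ (counted in vertices) has fewer than $d$ vertices. A superconcentrator with $N$ inputs and $N$ outputs is a DAG $G_S$ with inputs $i_1,\ldots,i_N$ and outputs $o_1,\ldots,o_N$ such that any $k$ inputs and any $k$ outputs are joined by $k$ vertex-disjoint paths; here $G_S$ is fixed to be Pippenger's superconcentrator with at most $42N$ vertices, indegree at most $16$ and depth at most $\log(42N)$. For $G$ with vertices $1,\ldots,N$, $\mathsf{superconc}(G)=(V(G_S),E(G_S)\cup E_I\cup E_O)$ with $E_I=\{(i_u,i_v):(u,v)\in E(G)\}$ and $E_O=\{(o_j,o_{j+1}):1\le j<N\}$. -}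

module Defs where

open import Level using (0ℓ)
open import Data.Nat using (ℕ; zero; suc; _+_; _*_; _≤_; _<_)
open import Data.Fin using (Fin; toℕ)
open import Data.Fin.Subset using (Subset; _∈_; _∉_; ∣_∣)
open import Data.List using (List; []; _∷_; length)
open import Data.List.Relation.Unary.All using (All)
import Data.List.Membership.Propositional as LM
open import Data.Product using (Σ; ∃; _×_)
open import Data.Sum using (_⊎_)
open import Data.Empty using (⊥)
open import Relation.Nullary using (¬_)
open import Relation.Binary.PropositionalEquality using (_≡_; _≢_)
open import Function.Definitions using (Injective)

Graph : ℕ → Set₁
Graph n = Fin n → Fin n → Set

data Walk {n : ℕ} (g : Graph n) : Fin n → Fin n → Set where
  [_] : (v : Fin n) → Walk g v v
  _∷_ : ∀ {u v w} → g u v → Walk g v w → Walk g u w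

vertices : ∀ {n} {g : Graph n} {u v} → Walk g u v → List (Fin n)
vertices ([ v ]) = v ∷ []
vertices (_∷_ {u = u} _ p) = u ∷ vertices p

edges : ∀ {n} {g : Graph n} {u v} → Walk g u v → ℕ
edges [ _ ] = 0
edges (_ ∷ p) = suc (edges p)

Acyclic : ∀ {n} → Graph n → Set
Acyclic {n} g = ∀ (v : Fin n) (p : Walk g v v) → ¬ (0 < edges p)

-- (e,d)-reducible: some S ⊆ V with |S| ≤ e such that every path of g - S has
-- fewer than d vertices (paths = walks, since the graphs considered are DAGs).
Reducible : ∀ {n} → Graph n → ℕ → ℕ → Set
Reducible {n} g e d =
  Σ (Subset n) λ S → ∣ S ∣ ≤ e ×
    (∀ u v (p : Walk g u v) → All (λ x → x ∉ S) (vertices p) → length (vertices p) < d)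

IndegreeAtMost : ∀ {n} → Graph n → ℕ → Set
IndegreeAtMost {n} g k =
  ∀ (v : Fin n) → Σ (List (Fin n)) λ L → length L ≤ k × (∀ u → g u v → u LM.∈ L)

DepthAtMost : ∀ {n} → Graph n → ℕ → Set
DepthAtMost {n} g D = ∀ u v (p : Walk g u v) → edges p ≤ D

Disjoint : ∀ {n} → List (Fin n) → List (Fin n) → Set
Disjoint xs ys = ∀ x → x LM.∈ xs → x LM.∈ ys → ⊥

-- Superconcentrator property of (gs, inputs i, outputs o), N inputs / N outputs:
-- for any k inputs i(a 0..k-1) (distinct) and any k outputs o(b 0..k-1) (distinct)
-- there are k pairwise vertex-disjoint paths, the j-th starting at i(a j) and
-- ending at one of the chosen outputs o(b (τ j)).  (Vertex-disjointness forces τ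
-- to be a bijection, so the k paths join the k inputs with the k outputs.)
SuperconcentratorProp : ∀ {m} (N : ℕ) → Graph m → (Fin N → Fin m) → (Fin N → Fin m) → Set
SuperconcentratorProp {m} N gs i o =
  ∀ (k : ℕ) (a b : Fin k → Fin N) → Injective _≡_ _≡_ a → Injective _≡_ _≡_ b →
    Σ (Fin k → Fin k) λ τ →
    Σ ((j : Fin k) → Walk gs (i (a j)) (o (b (τ j)))) λ P →
      ∀ j j' → j ≢ j' → Disjoint (vertices (P j)) (vertices (P j'))

-- The data assumed of G_S (Pippenger's superconcentrator with N inputs/outputs):
-- a DAG on m ≤ 42N vertices, indegree ≤ 16, depth ≤ log(42N) (base 2, integer
-- depth so ≤ ⌊log₂(42N)⌋ is given as a parameter D), distinct inputs and outputs,
-- inputs are sources, outputs are sinks, and the superconcentrator property.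
record IsPippengerLike (N m D : ℕ) (gs : Graph m) (i o : Fin N → Fin m) : Set where
  field
    acyclic   : Acyclic gs
    size      : m ≤ 42 * N
    indegree  : IndegreeAtMost gs 16
    depth     : DepthAtMost gs D
    inj-i     : Injective _≡_ _≡_ i
    inj-o     : Injective _≡_ _≡_ o
    i≢o       : ∀ a b → i a ≢ o b
    i-source  : ∀ u a → ¬ gs u (i a)
    o-sink    : ∀ b v → ¬ gs (o b) v
    superconc : SuperconcentratorProp N gs i o

-- superconc(G) = (V(G_S), E(G_S) ∪ E_I ∪ E_O), where
-- E_I = {(i_u, i_v) : (u,v) ∈ E(G)} and E_O = {(o_j, o_{j+1}) : 1 ≤ j < N}.
superconc : ∀ {N m} → Graph N → Graph m → (Fin N → Fin m) → (Fin N → Fin m) → Graph m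
superconc {N} g gs i o x y =
  gs x y
  ⊎ (Σ (Fin N) λ a → Σ (Fin N) λ b → g a b × x ≡ i a × y ≡ i b)
  ⊎ (Σ (Fin N) λ j → Σ (Fin N) λ j' → toℕ j' ≡ suc (toℕ j) × x ≡ o j × y ≡ o j')

module Submission where

-- Let S witness that G is (e,d)-reducible.  In H = superconc(G) we delete
--   S' = i(S) ∪ o(M),   M = {j : d divides j+1}  (every d-th output),
-- so |S'| ≤ |S| + |M| ≤ e + N/d.  Inputs are sources of G_S and outputs are
-- sinks of G_S, so a walk of H first runs through inputs along E_I edges, then
-- through G_S, and finally through outputs along E_O edges, never going back.
-- Avoiding S', the input phase is a walk of G - S (fewer than d vertices), the
-- G_S phase has at most D edges (the depth), and the output phase meets no
-- marked output, so it has at most d vertices.  Hence every walk of H - S' has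
-- fewer than d + D + d vertices, and D = ⌊log₂(42N)⌋ ≤ ⌈log₂(42N)⌉.

open import Defs
open import Data.Nat using (ℕ; _+_; _*_; _/_; NonZero)
open import Data.Nat.Logarithm using (⌊log₂_⌋; ⌈log₂_⌉)
open import Data.Fin using (Fin)

open import Data.Nat using (zero; suc; _∸_; _≤_; _<_; z≤n; s≤s; ⌈_/2⌉; ⌊_/2⌋; _%_)
open import Data.Nat.Base using (>-nonZero⁻¹)
open import Data.Nat.Properties
open import Data.Nat.DivMod using (m*n/n≡m; /-monoˡ-≤; m%n<n; m<n⇒m%n≡m;
  m≡m%n+[m/n]*n; [m+kn]%n≡m%n; n%n≡0; %-pred-≡0)
open import Data.Nat.Logarithm.Core using (⌊log2⌋; ⌈log2⌉; ⌊log2⌋-mono-≤)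
open import Data.Nat.Induction using (<-wellFounded)
open import Induction.WellFounded using (Acc; acc)
open import Data.Fin using (toℕ) renaming (zero to fzero; suc to fsuc)
open import Data.Fin.Subset using (Subset; Side; _∈_; _∉_; ∣_∣; _∪_; ⁅_⁆; ⊥; inside; outside)
open import Data.Fin.Subset.Properties using (x∈⁅x⁆; ∣⁅x⁆∣≡1; ∣⊥∣≡0; x∈p∪q⁺)
open import Data.Vec using ([]; _∷_; here; there)
open import Data.List using (length; _∷ʳ_)
open import Data.List.Properties using (length-++)
open import Data.List.Relation.Unary.All using (All; _∷_)
open import Data.List.Relation.Unary.All.Properties using (∷ʳ⁺)
open import Data.Product using (_,_)
open import Data.Sum using (inj₁; inj₂)
open import Data.Empty using (⊥-elim)
open import Relation.Binary.PropositionalEquality using (_≡_; _≢_; refl; sym; trans; cong; subst; module ≡-Reasoning)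
open import Function using (_∘_)

-- ⌊log₂ n⌋ ≤ ⌈log₂ n⌉: the depth bound of G_S uses the floor, the theorem the
-- ceiling.  Both recurse on ⌊n/2⌋ resp. ⌈n/2⌉ and ⌊n/2⌋ ≤ ⌈n/2⌉.
⌊log2⌋≤⌈log2⌉ : ∀ n (rec : Acc _<_ n) {rec' : Acc _<_ n} → ⌊log2⌋ n rec' ≤ ⌈log2⌉ n rec
⌊log2⌋≤⌈log2⌉ 0 _ = z≤n
⌊log2⌋≤⌈log2⌉ 1 _ = z≤n
⌊log2⌋≤⌈log2⌉ (suc (suc n)) (acc rs) {acc _} =
  s≤s (≤-trans (⌊log2⌋-mono-≤ {acc' = rs (⌈n/2⌉<n n)} (s≤s (⌊n/2⌋≤⌈n/2⌉ n)))
               (⌊log2⌋≤⌈log2⌉ (suc ⌈ n /2⌉) (rs (⌈n/2⌉<n n))))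

⌊log₂⌋≤⌈log₂⌉ : ∀ n → ⌊log₂ n ⌋ ≤ ⌈log₂ n ⌉
⌊log₂⌋≤⌈log₂⌉ n = ⌊log2⌋≤⌈log2⌉ n (<-wellFounded n)

∣p∪q∣≤∣p∣+∣q∣ : ∀ {n} (p q : Subset n) → ∣ p ∪ q ∣ ≤ ∣ p ∣ + ∣ q ∣
∣p∪q∣≤∣p∣+∣q∣ [] [] = z≤n
∣p∪q∣≤∣p∣+∣q∣ (inside ∷ p) (inside ∷ q) = s≤s (≤-trans (∣p∪q∣≤∣p∣+∣q∣ p q) (+-monoʳ-≤ ∣ p ∣ (n≤1+n ∣ q ∣)))
∣p∪q∣≤∣p∣+∣q∣ (inside ∷ p) (outside ∷ q) = s≤s (∣p∪q∣≤∣p∣+∣q∣ p q)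
∣p∪q∣≤∣p∣+∣q∣ (outside ∷ p) (inside ∷ q) = ≤-trans (s≤s (∣p∪q∣≤∣p∣+∣q∣ p q)) (≤-reflexive (sym (+-suc ∣ p ∣ ∣ q ∣)))
∣p∪q∣≤∣p∣+∣q∣ (outside ∷ p) (outside ∷ q) = ∣p∪q∣≤∣p∣+∣q∣ p q

image : ∀ {n m} → (Fin n → Fin m) → Subset n → Subset m
image f [] = ⊥
image f (inside ∷ P) = ⁅ f fzero ⁆ ∪ image (f ∘ fsuc) P
image f (outside ∷ P) = image (f ∘ fsuc) P

∣image∣≤ : ∀ {n m} (f : Fin n → Fin m) (P : Subset n) → ∣ image f P ∣ ≤ ∣ P ∣
∣image∣≤ {m = m} f [] = ≤-reflexive (∣⊥∣≡0 m)
∣image∣≤ f (inside ∷ P) = begin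
  ∣ ⁅ f fzero ⁆ ∪ image (f ∘ fsuc) P ∣   ≤⟨ ∣p∪q∣≤∣p∣+∣q∣ ⁅ f fzero ⁆ (image (f ∘ fsuc) P) ⟩
  ∣ ⁅ f fzero ⁆ ∣ + ∣ image (f ∘ fsuc) P ∣ ≡⟨ cong (_+ ∣ image (f ∘ fsuc) P ∣) (∣⁅x⁆∣≡1 (f fzero)) ⟩
  suc ∣ image (f ∘ fsuc) P ∣             ≤⟨ s≤s (∣image∣≤ (f ∘ fsuc) P) ⟩
  suc ∣ P ∣                              ∎
  where open ≤-Reasoning
∣image∣≤ f (outside ∷ P) = ∣image∣≤ (f ∘ fsuc) P

∈-image : ∀ {n m} (f : Fin n → Fin m) (P : Subset n) {a} → a ∈ P → f a ∈ image f P
∈-image f (inside ∷ P) here = x∈p∪q⁺ (inj₁ (x∈⁅x⁆ (f fzero)))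
∈-image f (inside ∷ P) (there a∈P) = x∈p∪q⁺ (inj₂ (∈-image (f ∘ fsuc) P a∈P))
∈-image f (outside ∷ P) (there a∈P) = ∈-image (f ∘ fsuc) P a∈P

-- The residue of k+1 modulo d is one more than
-- that of k unless k+1 is a multiple of d; this drives both the size bound
-- and the bound on walks through unmarked outputs.
module Multiples (d : ℕ) .{{_ : NonZero d}} where

  %-suc-shift : ∀ k → suc k % d ≡ suc (k % d) % d
  %-suc-shift k = begin
    suc k % d                     ≡⟨ cong (λ t → suc t % d) (m≡m%n+[m/n]*n k d) ⟩
    (suc (k % d) + k / d * d) % d ≡⟨ [m+kn]%n≡m%n (suc (k % d)) (k / d) d ⟩
    suc (k % d) % d               ∎
    where open ≡-Reasoning

  suc-% : ∀ k → suc k % d ≢ 0 → suc k % d ≡ suc (k % d)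
  suc-% k ≢0 with m≤n⇒m<n∨m≡n (m%n<n k d)
  ... | inj₁ lt = trans (%-suc-shift k) (m<n⇒m%n≡m lt)
  ... | inj₂ eq = ⊥-elim (≢0 (trans (%-suc-shift k) (trans (cong (_% d) eq) (n%n≡0 d))))

  -- A position is marked exactly when its residue modulo d is 0.
  sideOf : ℕ → Side
  sideOf zero = inside
  sideOf (suc _) = outside

  -- multiplesAfter s n ∋ j  iff  d divides s + j + 1 (for j < n).
  multiplesAfter : ℕ → (n : ℕ) → Subset n
  multiplesAfter s zero = []
  multiplesAfter s (suc n) = sideOf (suc s % d) ∷ multiplesAfter (suc s) n

  multiplesAfter-∈ : ∀ s n (j : Fin n) → suc (s + toℕ j) % d ≡ 0 → j ∈ multiplesAfter s n
  multiplesAfter-∈ s (suc n) fzero ≡0 =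
    subst (λ r → fzero ∈ sideOf r ∷ multiplesAfter (suc s) n)
          (sym (trans (cong (λ t → suc t % d) (sym (+-identityʳ s))) ≡0)) here
  multiplesAfter-∈ s (suc n) (fsuc j) ≡0 =
    there (multiplesAfter-∈ (suc s) n j (subst (λ t → suc t % d ≡ 0) (+-suc s (toℕ j)) ≡0))

  ∣multiplesAfter∣ : ∀ s n → ∣ multiplesAfter s n ∣ * d ≤ n + s % d
  ∣multiplesAfter∣ s zero = z≤n
  ∣multiplesAfter∣ s (suc n) with suc s % d in eq
  ... | zero = begin
    d + ∣ multiplesAfter (suc s) n ∣ * d ≤⟨ +-monoʳ-≤ d (∣multiplesAfter∣ (suc s) n) ⟩
    d + (n + suc s % d)                 ≡⟨ cong (λ t → d + (n + t)) eq ⟩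
    d + (n + 0)                         ≡⟨ cong (d +_) (+-identityʳ n) ⟩
    d + n                               ≡⟨ cong (_+ n) (sym (suc-pred d)) ⟩
    suc (d ∸ 1 + n)                     ≡⟨ cong suc (+-comm (d ∸ 1) n) ⟩
    suc n + (d ∸ 1)                     ≡⟨ cong (suc n +_) (sym (%-pred-≡0 eq)) ⟩
    suc n + s % d                       ∎
    where open ≤-Reasoning
  ... | suc _ = begin
    ∣ multiplesAfter (suc s) n ∣ * d ≤⟨ ∣multiplesAfter∣ (suc s) n ⟩
    n + suc s % d                   ≡⟨ cong (n +_) (suc-% s (λ ≡0 → 0≢1+n (trans (sym ≡0) eq))) ⟩
    n + suc (s % d)                 ≡⟨ +-suc n (s % d) ⟩
    suc n + s % d                   ∎
    where open ≤-Reasoning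

  multiples : (n : ℕ) → Subset n
  multiples = multiplesAfter 0

  ∣multiples∣≤n/d : ∀ n → ∣ multiples n ∣ ≤ n / d
  ∣multiples∣≤n/d n = subst (_≤ n / d) (m*n/n≡m ∣ multiples n ∣ d) (/-monoˡ-≤ d count)
    where
    count : ∣ multiples n ∣ * d ≤ n
    count = ≤-trans (∣multiplesAfter∣ 0 n)
                    (≤-reflexive (trans (cong (n +_) (m<n⇒m%n≡m (>-nonZero⁻¹ d))) (+-identityʳ n)))

len : ∀ {n} {g : Graph n} {u v} → Walk g u v → ℕ
len p = length (vertices p)

snoc : ∀ {n} {g : Graph n} {u v w} → Walk g u v → g v w → Walk g u w
snoc [ v ] e = e ∷ [ _ ]
snoc (e' ∷ p) e = e' ∷ snoc p e

edges-snoc : ∀ {n} {g : Graph n} {u v w} (p : Walk g u v) (e : g v w) → edges (snoc p e) ≡ suc (edges p)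
edges-snoc [ v ] e = refl
edges-snoc (e' ∷ p) e = cong suc (edges-snoc p e)

vertices-snoc : ∀ {n} {g : Graph n} {u v w} (p : Walk g u v) (e : g v w) →
  vertices (snoc p e) ≡ vertices p ∷ʳ w
vertices-snoc [ v ] e = refl
vertices-snoc (_∷_ {u = u} e' p) e = cong (u Data.List.∷_) (vertices-snoc p e)

len-snoc : ∀ {n} {g : Graph n} {u v w} (p : Walk g u v) (e : g v w) → len (snoc p e) ≡ suc (len p)
len-snoc {w = w} p e = begin
  length (vertices (snoc p e))   ≡⟨ cong length (vertices-snoc p e) ⟩
  length (vertices p ∷ʳ w)       ≡⟨ length-++ (vertices p) ⟩
  len p + 1                      ≡⟨ +-comm (len p) 1 ⟩
  suc (len p)                    ∎
  where open ≡-Reasoning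

all-snoc : ∀ {n} {g : Graph n} {u v w} {P : Fin n → Set} (p : Walk g u v) (e : g v w) →
  All P (vertices p) → P w → All P (vertices (snoc p e))
all-snoc {P = P} p e all-p pw = subst (All P) (sym (vertices-snoc p e)) (∷ʳ⁺ all-p pw)

all-head : ∀ {n} {g : Graph n} {u v} {P : Fin n → Set} (p : Walk g u v) → All P (vertices p) → P u
all-head [ v ] (pv ∷ _) = pv
all-head (e ∷ p) (pu ∷ _) = pu

module PathBound (N d : ℕ) .{{_ : NonZero d}} (G : Graph N) (S : Subset N)
  (short : ∀ u v (p : Walk G u v) → All (_∉ S) (vertices p) → len p < d)
  (m : ℕ) (GS : Graph m) (i o : Fin N → Fin m) (D : ℕ)
  (pip : IsPippengerLike N m D GS i o) where

  open IsPippengerLike pip using (depth; inj-i; inj-o; i≢o; i-source; o-sink)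
  open Multiples d

  H : Graph m
  H = superconc G GS i o

  S' : Subset m
  S' = image i S ∪ image o (multiples N)

  ∣S'∣≤ : ∣ S' ∣ ≤ ∣ S ∣ + N / d
  ∣S'∣≤ = ≤-trans (∣p∪q∣≤∣p∣+∣q∣ (image i S) (image o (multiples N)))
                  (+-mono-≤ (∣image∣≤ i S) (≤-trans (∣image∣≤ o (multiples N)) (∣multiples∣≤n/d N)))

  Avoids : ∀ {x v} → Walk H x v → Set
  Avoids p = All (_∉ S') (vertices p)

  input-∉S : ∀ {x} a → x ≡ i a → x ∉ S' → a ∉ S
  input-∉S a refl x∉S' a∈S = x∉S' (x∈p∪q⁺ (inj₁ (∈-image i S a∈S)))

  output-unmarked : ∀ {x} j → x ≡ o j → x ∉ S' → suc (toℕ j) % d ≢ 0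
  output-unmarked j refl x∉S' ≡0 =
    x∉S' (x∈p∪q⁺ (inj₂ (∈-image o (multiples N) (multiplesAfter-∈ 0 N j ≡0))))

  -- Output phase.  From o_j only E_O edges leave, and each step raises the
  -- residue j mod d by one, so len p + (j mod d) ≤ d.
  outputPhase : ∀ {x v} j → x ≡ o j → (p : Walk H x v) → Avoids p → len p + toℕ j % d ≤ d
  outputPhase j _ [ _ ] _ = m%n<n (toℕ j) d
  outputPhase j x≡o (inj₁ gs ∷ p) _ = ⊥-elim (o-sink j _ (subst (λ z → GS z _) x≡o gs))
  outputPhase j x≡o (inj₂ (inj₁ (a , _ , _ , x≡i , _)) ∷ p) _ = ⊥-elim (i≢o a j (trans (sym x≡i) x≡o))
  outputPhase j x≡o (inj₂ (inj₂ (j₁ , j' , j'≡1+j₁ , x≡o₁ , y≡o')) ∷ p) (x∉S' ∷ avoids)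
    with inj-o (trans (sym x≡o₁) x≡o)
  ... | refl = begin
    suc (len p + toℕ j % d)     ≡⟨ sym (+-suc (len p) (toℕ j % d)) ⟩
    len p + suc (toℕ j % d)     ≡⟨ cong (len p +_) (sym (suc-% (toℕ j) (output-unmarked j x≡o x∉S'))) ⟩
    len p + suc (toℕ j) % d     ≡⟨ cong (λ t → len p + t % d) (sym j'≡1+j₁) ⟩
    len p + toℕ j' % d          ≤⟨ outputPhase j' y≡o' p avoids ⟩
    d                           ∎
    where open ≤-Reasoning

  -- Middle phase.  q is the G_S walk travelled so far, ending at a non-input x;
  -- the rest p follows G_S edges and then enters the output phase.
  middlePhase : ∀ {y x v} (q : Walk GS y x) → (∀ a → x ≢ i a) → (p : Walk H x v) → Avoids p →
                edges q + len p ≤ D + d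
  middlePhase q _ [ _ ] _ = +-mono-≤ (depth _ _ q) (>-nonZero⁻¹ d)
  middlePhase {x = x} q _ (_∷_ {v = y} (inj₁ gs) p) (_ ∷ avoids) = begin
    edges q + suc (len p)     ≡⟨ +-suc (edges q) (len p) ⟩
    suc (edges q) + len p     ≡⟨ cong (_+ len p) (sym (edges-snoc q gs)) ⟩
    edges (snoc q gs) + len p ≤⟨ middlePhase (snoc q gs) not-input p avoids ⟩
    D + d                     ∎
    where
    open ≤-Reasoning
    not-input : ∀ a → y ≢ i a
    not-input a y≡i = i-source x a (subst (GS x) y≡i gs)
  middlePhase q x-not-input (inj₂ (inj₁ (a , _ , _ , x≡i , _)) ∷ p) _ = ⊥-elim (x-not-input a x≡i)
  middlePhase q _ (eO@(inj₂ (inj₂ (j , _ , _ , x≡o , _))) ∷ p) avoids =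
    +-mono-≤ (depth _ _ q) (≤-trans (m≤m+n _ _) (outputPhase j x≡o (eO ∷ p) avoids))

  -- A walk whose first edge lies in G_S: its second vertex is not an input
  -- (inputs are sources of G_S), so the middle phase starts with that edge.
  middlePhase-from : ∀ {x y v} (gs : GS x y) (p : Walk H y v) → Avoids p → suc (len p) ≤ D + d
  middlePhase-from {x} gs p avoids =
    middlePhase (gs ∷ [ _ ]) (λ a y≡i → i-source x a (subst (GS x) y≡i gs)) p avoids

  -- Input phase.  r is the walk of G - S travelled so far, ending at a with
  -- x = i_a; the rest p follows E_I edges and then enters the middle or
  -- output phase (a G_S edge or an E_O edge).
  inputPhase : ∀ {a₀ a x v} (r : Walk G a₀ a) → All (_∉ S) (vertices r) → x ≡ i a →
               (p : Walk H x v) → Avoids p → len r + len p < d + (D + d)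
  inputPhase r r-avoids _ [ _ ] _ =
    +-mono-<-≤ (short _ _ r r-avoids) (≤-trans (>-nonZero⁻¹ d) (m≤n+m d D))
  inputPhase r r-avoids x≡i (_∷_ {v = y} (inj₁ gs) p) (_ ∷ avoids) =
    +-mono-<-≤ (short _ _ r r-avoids) (middlePhase-from (subst (λ z → GS z y) x≡i gs) p avoids)
  inputPhase r r-avoids x≡i (inj₂ (inj₁ (a₁ , b , g , x≡i₁ , y≡i)) ∷ p) (_ ∷ avoids)
    with inj-i (trans (sym x≡i₁) x≡i)
  ... | refl = begin-strict
    len r + suc (len p)       ≡⟨ +-suc (len r) (len p) ⟩
    suc (len r) + len p       ≡⟨ cong (_+ len p) (sym (len-snoc r g)) ⟩
    len (snoc r g) + len p    <⟨ inputPhase (snoc r g) r'-avoids y≡i p avoids ⟩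
    d + (D + d)               ∎
    where
    open ≤-Reasoning
    r'-avoids : All (_∉ S) (vertices (snoc r g))
    r'-avoids = all-snoc r g r-avoids (input-∉S b y≡i (all-head p avoids))
  inputPhase {a = a} _ _ x≡i (inj₂ (inj₂ (j , _ , _ , x≡o , _)) ∷ p) _ = ⊥-elim (i≢o a j (trans (sym x≡i) x≡o))

  walk-bound : ∀ u v (p : Walk H u v) → Avoids p → len p < d + (D + d)
  walk-bound u v [ _ ] _ = +-mono-≤ (>-nonZero⁻¹ d) (≤-trans (>-nonZero⁻¹ d) (m≤n+m d D))
  walk-bound u v (inj₁ gs ∷ p) (_ ∷ avoids) =
    ≤-trans (s≤s (middlePhase-from gs p avoids)) (+-monoˡ-≤ (D + d) (>-nonZero⁻¹ d))
  walk-bound u v (eI@(inj₂ (inj₁ (a , _ , _ , u≡i , _))) ∷ p) (u∉S' ∷ avoids) =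
    ≤-trans (n≤1+n _) (inputPhase [ a ] (input-∉S a u≡i u∉S' ∷ []) u≡i (eI ∷ p) (u∉S' ∷ avoids))
    where open Data.List.Relation.Unary.All using ([])
  walk-bound u v (eO@(inj₂ (inj₂ (j , _ , _ , u≡o , _))) ∷ p) avoids =
    ≤-<-trans (≤-trans (m≤m+n _ _) (outputPhase j u≡o (eO ∷ p) avoids))
              (m<m+n d (≤-trans (>-nonZero⁻¹ d) (m≤n+m d D)))

d+[D+d]≤2d+C : ∀ d D C → D ≤ C → d + (D + d) ≤ 2 * d + C
d+[D+d]≤2d+C d D C D≤C = begin
  d + (D + d)   ≤⟨ +-monoʳ-≤ d (+-monoˡ-≤ d D≤C) ⟩
  d + (C + d)   ≡⟨ cong (d +_) (+-comm C d) ⟩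
  d + (d + C)   ≡⟨ sym (+-assoc d d C) ⟩
  d + d + C     ≡⟨ cong (λ t → d + t + C) (sym (+-identityʳ d)) ⟩
  2 * d + C     ∎
  where open ≤-Reasoning

lemmaD1 : ∀ (N e d : ℕ) .{{_ : NonZero d}} (G : Graph N) → Acyclic G → Reducible G e d →
    ∀ (m : ℕ) (GS : Graph m) (i o : Fin N → Fin m) →
    IsPippengerLike N m ⌊log₂ (42 * N) ⌋ GS i o →
    Reducible (superconc G GS i o) (e + N / d) (2 * d + ⌈log₂ (42 * N) ⌉)
lemmaD1 N e d G _ (S , ∣S∣≤e , short) m GS i o pip =
  S' , ≤-trans ∣S'∣≤ (+-monoˡ-≤ (N / d) ∣S∣≤e) ,
  λ u v p avoids → <-≤-trans (walk-bound u v p avoids)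
                     (d+[D+d]≤2d+C d D _ (⌊log₂⌋≤⌈log₂⌉ (42 * N)))
  where
  D : ℕ
  D = ⌊log₂ (42 * N) ⌋
  open PathBound N d G S short m GS i o D pip using (S'; ∣S'∣≤; walk-bound)
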